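{- Let $k\geq 2$ and let $G$ be a graph with a dangling induced subgraph isomorphic to $C_{2k-1}$. Suppose $G$ has a $k$-role colouring whose role graph $R$ is connected. Then $R\in\{P_k^*,P_k^{**}\}$ (up to renaming colours).
   Context: Graphs are finite, undirected, without multiple edges, possibly with loops. An induced subgraph $H$ of $G$ is dangling if exactly one vertex $v$ of $H$ (the hook) has exactly one neighbour in $V(G)\setminus V(H)$ and all other vertices of $H$ have no neighbours in $V(G)\setminus V(H)$. A role colouring of $G$ is a map $r:V(G)\to\mathbb{N}^+$ such that $r(u)=r(v)$ implies $\{r(u'):u'\in N(u)\}=\{r(v'):v'\in N(v)\}$; it is a $k$-role colouring if exactly $k$ colours are used. Its role graph is the graph on the used colours with an edge $\{x,y\}$ (possibly a loop) whenever some vertex of colour $x$ has a neighbour of colour $y$. $P_k$ has vertex set $\{1,\ldots,k\}$ and edges $\{i,i+1\}$, $1\le i<k$; $P_k^*$ is $P_k$ plus a loop at $k$; $P_k^{**}$ is $P_k$ plus loops at $1$ and $k$; $C_n$ is the cycle on $n$ vertices. -}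

module Defs where

open import Data.Nat using (ℕ; zero; suc; _∸_; _*_; _%_; NonZero)
open import Data.Fin using (Fin; toℕ)
open import Data.Bool using (Bool; true)
open import Data.Product using (Σ; ∃; ∃-syntax; _×_; _,_)
open import Data.Sum using (_⊎_)
open import Relation.Binary.PropositionalEquality using (_≡_; _≢_)
open import Relation.Nullary using (¬_)
open import Data.Fin.Permutation using (Permutation′; _⟨$⟩ʳ_)
open import Function.Bundles using (_⇔_)

-- A finite undirected graph (no multiple edges, loops allowed) on vertex set Fin n.
record Graph : Set where
  field
    n   : ℕ
    adj : Fin n → Fin n → Bool
    sym : ∀ u v → adj u v ≡ adj v u
open Graph public

Edge : (G : Graph) → Fin (n G) → Fin (n G) → Set
Edge G u v = adj G u v ≡ true

CycleAdj : (m : ℕ) .{{_ : NonZero m}} → Fin m → Fin m → Set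
CycleAdj m i j = (toℕ j ≡ suc (toℕ i) % m) ⊎ (toℕ i ≡ suc (toℕ j) % m)

-- f : Fin m → V(G) is an isomorphism of a graph on Fin m (adjacency A) onto the
-- induced subgraph of G on the image of f.
InducedCopy : (G : Graph) (m : ℕ) (A : Fin m → Fin m → Set) (f : Fin m → Fin (n G)) → Set
InducedCopy G m A f =
  (∀ i j → f i ≡ f j → i ≡ j) × (∀ i j → Edge G (f i) (f j) ⇔ A i j)

Outside : (G : Graph) {m : ℕ} (f : Fin m → Fin (n G)) → Fin (n G) → Set
Outside G f w = ∀ i → f i ≢ w

Dangling : (G : Graph) {m : ℕ} (f : Fin m → Fin (n G)) → Set
Dangling G {m} f = ∃[ h ]
  ( (∃[ w ] (Outside G f w × Edge G (f h) w
             × (∀ w' → Outside G f w' → Edge G (f h) w' → w' ≡ w)))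
  × (∀ i → i ≢ h → ∀ w → Outside G f w → ¬ Edge G (f i) w))

HasDanglingCycle : (G : Graph) (m : ℕ) .{{_ : NonZero m}} → Set
HasDanglingCycle G m =
  ∃[ f ] (InducedCopy G m (CycleAdj m) f × Dangling G f)

-- A role colouring using exactly k colours, with colours named 0..k-1 (a surjection).
IsRoleColouring : (G : Graph) (k : ℕ) (r : Fin (n G) → Fin k) → Set
IsRoleColouring G k r =
  (∀ c → ∃[ v ] r v ≡ c)
  × (∀ u v → r u ≡ r v →
       (∀ u' → Edge G u u' → ∃[ v' ] (Edge G v v' × r v' ≡ r u'))
     × (∀ v' → Edge G v v' → ∃[ u' ] (Edge G u u' × r u' ≡ r v')))

RoleAdj : (G : Graph) {k : ℕ} (r : Fin (n G) → Fin k) → Fin k → Fin k → Set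
RoleAdj G r x y = ∃[ u ] ∃[ v ] (r u ≡ x × r v ≡ y × Edge G u v)

data Walk {k : ℕ} (A : Fin k → Fin k → Set) : Fin k → Fin k → Set where
  here : ∀ {x} → Walk A x x
  step : ∀ {x y z} → A x y → Walk A y z → Walk A x z

Connected : {k : ℕ} (A : Fin k → Fin k → Set) → Set
Connected A = ∀ x y → Walk A x y

-- P_k on vertex set Fin k (vertex i+1 of the paper is i here).
PathAdj : (k : ℕ) → Fin k → Fin k → Set
PathAdj k i j = (toℕ j ≡ suc (toℕ i)) ⊎ (toℕ i ≡ suc (toℕ j))

PStarAdj : (k : ℕ) → Fin k → Fin k → Set
PStarAdj k i j = PathAdj k i j ⊎ (i ≡ j × toℕ i ≡ k ∸ 1)

PStarStarAdj : (k : ℕ) → Fin k → Fin k → Set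
PStarStarAdj k i j = PStarAdj k i j ⊎ (i ≡ j × toℕ i ≡ 0)

Isomorphic : {k : ℕ} (A B : Fin k → Fin k → Set) → Set
Isomorphic {k} A B = Σ (Permutation′ k) λ σ → ∀ x y → A x y ⇔ B (σ ⟨$⟩ʳ x) (σ ⟨$⟩ʳ y)

module Submission where

-- Number the vertices of the dangling cycle C_m (m = 2k-1) as
-- positions i ∈ ℕ read modulo m, starting at the hook (position 0), and let
-- X i be the colour of position i; write M = m-1, so position i+M is the
-- predecessor i-1.  Because the cycle is induced and only the hook has a
-- neighbour outside it, the role-graph neighbourhood of the colour X i is
-- exactly {X (i-1), X (i+1)} whenever i is not the hook ("i is good"), while
-- the hook colour may have one extra neighbour ρ.
--
--  1. A sequence obeying this path rule is determined by two consecutive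
--     values (module PathRule); this lets us compare readings of X.
--  2. Connectivity of R puts every colour on the cycle.
--  3. There is a symmetry axis a with X (a+t) = X (a-t) for t ≤ k: among k+1
--     consecutive positions some colour repeats; a repeat either propagates
--     as a translation of period < k (impossible: too few colours would
--     occur) or reflects inwards until it closes up as an axis.
--  4. Along an axis the colours X a, …, X (a+k-1) are all k colours, each
--     adjacent exactly to its path neighbours, with a loop at the last one;
--     a loop at the first one occurs exactly when a is the hook and ρ = X a.
--     Hence R ≅ P_k^* or R ≅ P_k^**.

open import Defs hiding (sym)
open import Data.Nat using (ℕ; zero; suc; s≤s⁻¹; _∸_; _*_; _≥_; _+_; _≤_; _<_; z≤n; s≤s; _%_; _/_; NonZero)
open import Data.Nat.Properties
open import Data.Nat.DivMod
open import Data.Nat.Tactic.RingSolver using (solve-∀)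
open import Data.Fin using (Fin; toℕ; fromℕ<; punchIn; punchOut) renaming (zero to fzero; suc to fsuc)
open import Data.Fin.Properties using (toℕ-injective; toℕ-fromℕ<; pigeonhole; punchOut-injective; punchIn-punchOut; injective⇒≤; any?; toℕ<n) renaming (_≟_ to _≟F_)
open import Data.Sum using (_⊎_; inj₁; inj₂; [_,_]; swap; reduce)
open import Data.Product using (Σ; ∃-syntax; _×_; _,_; proj₁; proj₂)
open import Data.Empty using (⊥; ⊥-elim)
open import Function using (_∘_)
open import Relation.Nullary using (¬_; Dec; yes; no)
open import Relation.Nullary.Decidable using (_×-dec_)
open import Relation.Binary.Definitions using (tri<; tri≈; tri>)
open import Relation.Binary.PropositionalEquality using (_≡_; _≢_; refl; sym; trans; cong; subst; subst₂)
open import Function.Bundles using (_⇔_; mk⇔; Equivalence)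
open import Data.Fin.Permutation using (permutation)

Iff : Set → Set → Set
Iff A B = (A → B) × (B → A)

OneOf : {A : Set} → A → A → A → Set
OneOf y a b = y ≡ a ⊎ y ≡ b

SamePair : {A : Set} → A → A → A → A → Set
SamePair a b c d = ∀ y → Iff (OneOf y a b) (OneOf y c d)

samePair-cancelˡ : {A : Set} {a b d : A} → SamePair a b a d → b ≡ d
samePair-cancelˡ {b = b} {d} S with proj₁ (S b) (inj₂ refl)
... | inj₂ b≡d = b≡d
... | inj₁ b≡a with proj₂ (S d) (inj₂ refl)
...   | inj₁ d≡a = trans b≡a (sym d≡a)
...   | inj₂ d≡b = sym d≡b

samePair-swapʳ : {A : Set} {a b c d : A} → SamePair a b c d → SamePair a b d c
samePair-swapʳ S y = (swap ∘ proj₁ (S y)) , (proj₂ (S y) ∘ swap)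

samePair-match : {A : Set} {a b c d : A} → SamePair a b c d → (a ≡ c × b ≡ d) ⊎ (a ≡ d × b ≡ c)
samePair-match {a = a} {b} {c} {d} S with proj₁ (S a) (inj₁ refl)
... | inj₁ refl = inj₁ (refl , samePair-cancelˡ S)
... | inj₂ refl = inj₂ (refl , samePair-cancelˡ (samePair-swapʳ S))

oneOf-exhaust : {A : Set} {a b c d y : A} → a ≢ b → OneOf a c d → OneOf b c d → OneOf y c d → OneOf y a b
oneOf-exhaust a≢b (inj₁ refl) (inj₁ refl) _ = ⊥-elim (a≢b refl)
oneOf-exhaust a≢b (inj₁ refl) (inj₂ refl) y∈ = y∈
oneOf-exhaust a≢b (inj₂ refl) (inj₁ refl) y∈ = swap y∈
oneOf-exhaust a≢b (inj₂ refl) (inj₂ refl) _ = ⊥-elim (a≢b refl)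

-- Counting on finite sets.  A surjection Fin D → Fin k forces k ≤ D, because
-- any choice of preimages is injective.
surjection⇒≤ : ∀ {D k} (h : Fin D → Fin k) → (∀ y → ∃[ x ] h x ≡ y) → k ≤ D
surjection⇒≤ h onto = injective⇒≤ {f = proj₁ ∘ onto}
  (λ {y} {z} e → trans (sym (proj₂ (onto y))) (trans (cong h e) (proj₂ (onto z))))

-- Hence a surjection Fin n → Fin n is injective: identifying two points
-- would leave a surjection from the remaining n-1 points.
surjective⇒injective : ∀ {n} (f : Fin n → Fin n) → (∀ y → ∃[ x ] f x ≡ y) → ∀ s t → f s ≡ f t → s ≡ t
surjective⇒injective {suc n} f onto s t fs≡ft with s ≟F t
... | yes s≡t = s≡t
... | no s≢t = ⊥-elim (1+n≰n (surjection⇒≤ (f ∘ punchIn t) covered))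
  where
  covered : ∀ y → ∃[ x ] f (punchIn t x) ≡ y
  covered y with onto y
  ... | x , fx≡y with x ≟F t
  ...   | yes refl = punchOut (s≢t ∘ sym) , trans (cong f (punchIn-punchOut (s≢t ∘ sym))) (trans fs≡ft fx≡y)
  ...   | no x≢t = punchOut (x≢t ∘ sym) , trans (cong f (punchIn-punchOut (x≢t ∘ sym))) fx≡y

injective⇒surjective : ∀ {n} (f : Fin n → Fin n) → (∀ s t → f s ≡ f t → s ≡ t) → ∀ y → ∃[ x ] f x ≡ y
injective⇒surjective {suc n} f inj y with any? (λ x → f x ≟F y)
... | yes hit = hit
... | no miss = ⊥-elim (1+n≰n (injective⇒≤ {f = avoid} avoid-injective))
  where
  avoid : Fin (suc n) → Fin n
  avoid x = punchOut {i = y} {j = f x} (λ e → miss (x , sym e))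
  avoid-injective : ∀ {s t} → avoid s ≡ avoid t → s ≡ t
  avoid-injective {s} {t} e = inj s t (punchOut-injective {i = y} _ _ e)

injective-from-< : ∀ {n} {A : Set} (f : Fin n → A) → (∀ i j → toℕ i < toℕ j → f i ≢ f j) →
                   ∀ i j → f i ≡ f j → i ≡ j
injective-from-< f sep i j e with <-cmp (toℕ i) (toℕ j)
... | tri< i<j _ _ = ⊥-elim (sep i j i<j e)
... | tri≈ _ i≡j _ = toℕ-injective i≡j
... | tri> _ _ j<i = ⊥-elim (sep j i j<i (sym e))

-- Relations on Fin k that correspond along a bijection are isomorphic; a
-- surjective correspondence col : Fin k → Fin k is automatically bijective.
iso-from-onto : ∀ {k} (A B : Fin k → Fin k → Set) (col : Fin k → Fin k) → (∀ y → ∃[ t ] col t ≡ y) →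
                (∀ s t → Iff (A (col s) (col t)) (B s t)) → Isomorphic A B
iso-from-onto {k} A B col onto corr = permutation idx col idx-col col-idx , λ x y →
  mk⇔ (λ a → proj₁ (corr (idx x) (idx y)) (subst₂ A (sym (col-idx x)) (sym (col-idx y)) a))
      (λ b → subst₂ A (col-idx x) (col-idx y) (proj₂ (corr (idx x) (idx y)) b))
  where
  idx : Fin k → Fin k
  idx y = proj₁ (onto y)
  col-idx : ∀ y → col (idx y) ≡ y
  col-idx y = proj₂ (onto y)
  idx-col : ∀ t → idx (col t) ≡ t
  idx-col t = surjective⇒injective col onto _ _ (col-idx (col t))

%-cong-+ʳ : ∀ n .{{_ : NonZero n}} {i j} c → i % n ≡ j % n → (i + c) % n ≡ (j + c) % n
%-cong-+ʳ n {i} {j} c e =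
  trans (%-distribˡ-+ i c n) (trans (cong (λ z → (z + c % n) % n) e) (sym (%-distribˡ-+ j c n)))

%-cong-+ˡ : ∀ n .{{_ : NonZero n}} {i j} c → i % n ≡ j % n → (c + i) % n ≡ (c + j) % n
%-cong-+ˡ n {i} {j} c e =
  trans (%-distribˡ-+ c i n) (trans (cong (λ z → (c % n + z) % n) e) (sym (%-distribˡ-+ c j n)))

%-absorbʳ : ∀ a b n .{{_ : NonZero n}} → (a + b % n) % n ≡ (a + b) % n
%-absorbʳ a b n = trans (%-distribˡ-+ a (b % n) n)
  (trans (cong (λ z → (a % n + z) % n) (m%n%n≡m%n b n)) (sym (%-distribˡ-+ a b n)))

%-absorbˡ : ∀ a b n .{{_ : NonZero n}} → (a % n + b) % n ≡ (a + b) % n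
%-absorbˡ a b n = trans (cong (_% n) (+-comm (a % n) b)) (trans (%-absorbʳ b a n) (cong (_% n) (+-comm b a)))

<⇒+suc : ∀ {x y} → x < y → Σ ℕ λ d → y ≡ x + suc d
<⇒+suc {x} {y} lt = y ∸ suc x , sym (trans (+-suc x (y ∸ suc x)) (m+[n∸m]≡n lt))

module PathRule {C : Set} (N : C → C → Set) where

  Rule : (ℕ → C) → ℕ → Set
  Rule S t = ∀ y → Iff (N (S (suc t)) y) (OneOf y (S t) (S (suc (suc t))))

  rule-cong : ∀ {A B t} → A t ≡ B t → A (suc t) ≡ B (suc t) → A (suc (suc t)) ≡ B (suc (suc t)) →
              Rule A t → Rule B t
  rule-cong e0 e1 e2 R y rewrite sym e0 | sym e1 | sym e2 = R y

  same-middle : ∀ {A B t} → Rule A t → Rule B t → A (suc t) ≡ B (suc t) →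
                SamePair (A t) (A (suc (suc t))) (B t) (B (suc (suc t)))
  same-middle RA RB e y = (λ q → proj₁ (RB y) (subst (λ z → N z y) e (proj₂ (RA y) q))) ,
                          (λ q → proj₁ (RA y) (subst (λ z → N z y) (sym e) (proj₂ (RB y) q)))

  agree-pair : (A B : ℕ → C) (L : ℕ) → (∀ t → t < L → Rule A t) → (∀ t → t < L → Rule B t) →
               A 0 ≡ B 0 → A 1 ≡ B 1 → ∀ t → t ≤ L → A t ≡ B t × A (suc t) ≡ B (suc t)
  agree-pair A B L RA RB e0 e1 zero _ = e0 , e1
  agree-pair A B L RA RB e0 e1 (suc t) t<L with agree-pair A B L RA RB e0 e1 t (≤-trans (n≤1+n t) t<L)
  ... | At≡Bt , At+1≡Bt+1 = At+1≡Bt+1 , samePair-cancelˡ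
        (subst (λ z → SamePair (A t) (A (suc (suc t))) z (B (suc (suc t)))) (sym At≡Bt)
               (same-middle {A} {B} (RA t t<L) (RB t t<L) At+1≡Bt+1))

  agree : (A B : ℕ → C) (L : ℕ) → (∀ t → t < L → Rule A t) → (∀ t → t < L → Rule B t) →
          A 0 ≡ B 0 → A 1 ≡ B 1 → ∀ t → t ≤ suc L → A t ≡ B t
  agree A B L RA RB e0 e1 zero _ = e0
  agree A B L RA RB e0 e1 (suc t) t≤L = proj₂ (agree-pair A B L RA RB e0 e1 t (≤-pred t≤L))

-- X i is the colour at
-- position i of a cycle of length m = 2k-1 with hook at position 0, N is
-- the role graph and ρ the colour of the hook's outside neighbour.
module RoleCycle (K2 : ℕ)
  (X : ℕ → Fin (suc (suc K2)))
  (N : Fin (suc (suc K2)) → Fin (suc (suc K2)) → Set)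
  (ρ : Fin (suc (suc K2)))
  (periodic : ∀ i → X (i + suc (suc K2 + suc K2)) ≡ X i)
  (off-hook : ∀ i → 1 ≤ i → i ≤ suc K2 + suc K2 →
     ∀ y → Iff (N (X i) y) (OneOf y (X (i + (suc K2 + suc K2))) (X (suc i))))
  (at-hook : ∀ y → N (X 0) y → OneOf y (X (suc K2 + suc K2)) (X 1) ⊎ y ≡ ρ)
  (hook-ρ : N (X 0) ρ)
  (N-sym : ∀ {x y} → N x y → N y x)
  (connected : ∀ x y → Walk N x y)
  where

  K1 k M m : ℕ
  K1 = suc K2
  k = suc K1
  M = K1 + K1
  m = suc M

  Colour : Set
  Colour = Fin k

  open PathRule N

  k≤M : k ≤ M
  k≤M = s≤s (m≤n+m (suc K2) K2)

  k≤m : k ≤ m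
  k≤m = ≤-trans k≤M (n≤1+n M)

  X-periodic : ∀ i q → X (i + q * m) ≡ X i
  X-periodic i zero = cong X (+-identityʳ i)
  X-periodic i (suc q) = trans (cong X (one-more i q m)) (trans (periodic (i + q * m)) (X-periodic i q))
    where
    one-more : ∀ i q m → i + suc q * m ≡ (i + q * m) + m
    one-more = solve-∀

  X-mod : ∀ i → X i ≡ X (i % m)
  X-mod i = trans (cong X (m≡m%n+[m/n]*n i m)) (X-periodic (i % m) (i / m))

  X-cong-mod : ∀ {i j} → i % m ≡ j % m → X i ≡ X j
  X-cong-mod {i} {j} e = trans (X-mod i) (trans (cong X e) (sym (X-mod j)))

  -- Position i is good when the neighbourhood of its colour is that of a
  -- path vertex: the colours of i-1 (written i+M) and i+1.
  Good : ℕ → Set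
  Good i = ∀ y → Iff (N (X i) y) (OneOf y (X (i + M)) (X (suc i)))

  good-at : ∀ {i a b} → Good i → X (i + M) ≡ a → X (suc i) ≡ b → ∀ y → Iff (N (X i) y) (OneOf y a b)
  good-at G refl refl = G

  good-mod : ∀ {i j} → i % m ≡ j % m → Good i → Good j
  good-mod {i} {j} e G =
    subst (λ z → ∀ y → Iff (N z y) (OneOf y (X (j + M)) (X (suc j)))) (X-cong-mod e)
          (good-at G (X-cong-mod (%-cong-+ʳ m {i} {j} M e)) (X-cong-mod (%-cong-+ˡ m {i} {j} 1 e)))

  good-offHook : ∀ i → 1 ≤ i % m → Good i
  good-offHook i p = good-mod (m%n%n≡m%n i m) (off-hook (i % m) p (≤-pred (m%n<n i m)))

  good-same-colour : ∀ {i j} → Good i → Good j → X i ≡ X j →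
                     SamePair (X (i + M)) (X (suc i)) (X (j + M)) (X (suc j))
  good-same-colour Gi Gj e y = (λ p → proj₁ (Gj y) (subst (λ z → N z y) e (proj₂ (Gi y) p))) ,
                               (λ p → proj₁ (Gi y) (subst (λ z → N z y) (sym e) (proj₂ (Gj y) p)))

  forward-rule : ∀ p t → Good (p + suc t) → Rule (λ s → X (p + s)) t
  forward-rule p t G = good-at G (trans (cong X (step-back p t M)) (periodic (p + t)))
                                 (cong X (sym (+-suc p (suc t))))
    where
    step-back : ∀ p t M → p + suc t + M ≡ p + t + suc M
    step-back = solve-∀

  -- ... and so does X read backwards (a step of M is a step of -1 mod m).
  backward-rule : ∀ p t → Good (p + suc t * M) → Rule (λ s → X (p + s * M)) t
  backward-rule p t G y = (swap ∘ proj₁ H) , (proj₂ H ∘ swap)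
    where
    one-back : ∀ p t M → p + suc t * M + M ≡ p + suc (suc t) * M
    one-back = solve-∀
    one-forward : ∀ p t M → suc (p + suc t * M) ≡ p + t * M + suc M
    one-forward = solve-∀
    H : Iff (N (X (p + suc t * M)) y) (OneOf y (X (p + suc (suc t) * M)) (X (p + t * M)))
    H = good-at G (cong X (one-back p t M)) (trans (cong X (one-forward p t M)) (periodic (p + t * M))) y

  backward-eq : ∀ p s → s ≤ p → p + s * M ≡ (p ∸ s) + s * m
  backward-eq p s s≤p = trans (cong (_+ s * M) (sym (m∸n+n≡m s≤p))) (regroup (p ∸ s) s M)
    where
    regroup : ∀ q s M → q + s + s * M ≡ q + s * suc M
    regroup = solve-∀

  X-backward : ∀ p s → s ≤ p → X (p + s * M) ≡ X (p ∸ s)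
  X-backward p s s≤p = trans (cong X (backward-eq p s s≤p)) (X-periodic (p ∸ s) s)

  good-backward : ∀ p t → suc t < p → p ≤ m → Good (p + suc t * M)
  good-backward p t lt p≤m = good-mod (sym (trans (cong (_% m) (backward-eq p (suc t) (<⇒≤ lt)))
                                                  ([m+kn]%n≡m%n (p ∸ suc t) (suc t) m)))
    (off-hook (p ∸ suc t) (m<n⇒0<n∸m lt) (∸-mono p≤m (s≤s z≤n)))

  X-times-M : ∀ t → t ≤ m → X (t * M) ≡ X (m ∸ t)
  X-times-M t t≤m = trans (sym (periodic (t * M))) (trans (cong X (+-comm (t * M) m)) (X-backward m t t≤m))

  Axis : ℕ → Set
  Axis a = ∀ t → t ≤ k → X (a + t) ≡ X (a + t * M)

  HookRepeats : Set
  HookRepeats = Σ ℕ λ s → 1 ≤ s × s ≤ M × X s ≡ X 0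

  hookRepeats? : Dec HookRepeats
  hookRepeats? with any? (λ (f : Fin M) → X (suc (toℕ f)) ≟F X 0)
  ... | yes (f , e) = yes (suc (toℕ f) , s≤s z≤n , toℕ<n f , e)
  ... | no none = no λ { (zero , () , _) ; (suc s , _ , s≤M , e) →
         none (fromℕ< s≤M , trans (cong (λ z → X (suc z)) (toℕ-fromℕ< s≤M)) e) }

  -- Reading inside the window 1 … m.  Parallel repeat: if X i = X j and
  -- X (i-1) = X (j-1) for 1 ≤ i < j ≤ m, reading both backwards i steps
  -- shows X 0 = X (j-i).
  window-parallel : ∀ i' d → suc i' + suc d ≤ m → X (suc i') ≡ X (suc i' + suc d) →
                    X (suc i' + M) ≡ X (suc i' + suc d + M) → X 0 ≡ X (suc d)
  window-parallel i' d j≤m e pred≡ =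
    trans (sym (trans (X-backward i i ≤-refl) (cong X (n∸n≡0 i))))
     (trans (agree A B i' RA RB e0 e1 i ≤-refl)
      (trans (X-backward j i (m≤m+n i (suc d))) (cong X (m+n∸m≡n i (suc d)))))
    where
    i j : ℕ
    i = suc i'
    j = i + suc d
    A B : ℕ → Colour
    A t = X (i + t * M)
    B t = X (j + t * M)
    RA : ∀ t → t < i' → Rule A t
    RA t lt = backward-rule i t (good-backward i t (s≤s lt) (≤-trans (m≤m+n i (suc d)) j≤m))
    RB : ∀ t → t < i' → Rule B t
    RB t lt = backward-rule j t (good-backward j t (≤-trans (s≤s lt) (s≤s (m≤m+n i' (suc d)))) j≤m)
    e0 : A 0 ≡ B 0
    e0 = trans (cong X (+-identityʳ i)) (trans e (cong X (sym (+-identityʳ j))))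
    e1 : A 1 ≡ B 1
    e1 = trans (cong (λ z → X (i + z)) (+-identityʳ M)) (trans pred≡ (cong (λ z → X (j + z)) (sym (+-identityʳ M))))

  -- Bounce: if X (a+1) = X (a-1) with 2a ≤ M, reading forwards and
  -- backwards from a shows X (2a) = X 0.
  window-bounce : ∀ a' → suc a' + suc a' ≤ M → X (suc (suc a')) ≡ X (suc a' + M) → X 0 ≡ X (suc a' + suc a')
  window-bounce a' 2a≤M bounce =
    sym (trans (agree A B a' RA RB refl e1 a ≤-refl) (trans (X-backward a a ≤-refl) (cong X (n∸n≡0 a))))
    where
    a : ℕ
    a = suc a'
    a≤M : a ≤ M
    a≤M = ≤-trans (m≤m+n a a) 2a≤M
    A B : ℕ → Colour
    A t = X (a + t)
    B t = X (a + t * M)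
    RA : ∀ t → t < a' → Rule A t
    RA t lt = forward-rule a t (off-hook (a + suc t) (s≤s z≤n) (≤-trans (+-monoʳ-≤ a (≤-trans lt (n≤1+n a'))) 2a≤M))
    RB : ∀ t → t < a' → Rule B t
    RB t lt = backward-rule a t (good-backward a t (s≤s lt) (≤-trans a≤M (n≤1+n M)))
    e1 : A 1 ≡ B 1
    e1 = trans (cong X (+-comm a 1)) (trans bounce (cong (λ z → X (a + z)) (sym (+-identityʳ M))))

  loop-reflects : ∀ b → Good b → Good (suc b) → X b ≡ X (suc b) → X (b + M) ≡ X (suc (suc b))
  loop-reflects b Gb Gb+1 loop = samePair-cancelˡ S
    where
    S : SamePair (X b) (X (b + M)) (X b) (X (suc (suc b)))
    S y = (λ q → proj₁ (nbrs-b+1 y) (subst (λ z → N z y) loop (proj₂ (nbrs-b y) (swap q)))) ,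
          (λ q → swap (proj₁ (nbrs-b y) (subst (λ z → N z y) (sym loop) (proj₂ (nbrs-b+1 y) q))))
      where
      nbrs-b : ∀ y → Iff (N (X b) y) (OneOf y (X (b + M)) (X b))
      nbrs-b = good-at Gb refl (sym loop)
      nbrs-b+1 : ∀ y → Iff (N (X (suc b)) y) (OneOf y (X b) (X (suc (suc b))))
      nbrs-b+1 = good-at Gb+1 (trans (cong X (sym (+-suc b M))) (periodic b)) refl

  window-loop : ∀ b' → suc b' ≤ K1 → X (suc b') ≡ X (suc (suc b')) →
                ∀ s → s ≤ suc b' → X (suc (suc b') + s) ≡ X (suc b' + s * M)
  window-loop b' b≤K1 loop = agree A B b' RA RB e0 e1
    where
    b : ℕ
    b = suc b'
    b≤M : b ≤ M
    b≤M = ≤-trans b≤K1 (m≤m+n K1 K1)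
    b+1≤M : suc b ≤ M
    b+1≤M = ≤-trans (s≤s b≤K1) k≤M
    double : ∀ b' → suc (suc b') + b' ≡ suc b' + suc b'
    double = solve-∀
    A B : ℕ → Colour
    A t = X (suc b + t)
    B t = X (b + t * M)
    RA : ∀ t → t < b' → Rule A t
    RA t lt = forward-rule (suc b) t (off-hook (suc b + suc t) (s≤s z≤n)
      (≤-trans (+-monoʳ-≤ (suc b) lt) (≤-trans (≤-reflexive (double b')) (+-mono-≤ b≤K1 b≤K1))))
    RB : ∀ t → t < b' → Rule B t
    RB t lt = backward-rule b t (good-backward b t (s≤s lt) (≤-trans b≤M (n≤1+n M)))
    e0 : A 0 ≡ B 0
    e0 = trans (cong X (+-identityʳ (suc b))) (trans (sym loop) (cong X (sym (+-identityʳ b))))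
    e1 : A 1 ≡ B 1
    e1 = trans (cong X (+-comm (suc b) 1))
           (trans (sym (loop-reflects b (off-hook b (s≤s z≤n) b≤M) (off-hook (suc b) (s≤s z≤n) b+1≤M) loop))
                  (cong (λ z → X (b + z)) (sym (+-identityʳ M))))

  axis-at-hook-bounce : X 1 ≡ X M → Axis 0
  axis-at-hook-bounce bounce t t≤k = trans (agree A B M RA RB e0 e1 t (≤-trans t≤k k≤m))
                                           (trans (cong X (+-comm m (t * M))) (periodic (t * M)))
    where
    A B : ℕ → Colour
    A t = X t
    B t = X (m + t * M)
    RA : ∀ t → t < M → Rule A t
    RA t lt = forward-rule 0 t (off-hook (suc t) (s≤s z≤n) lt)
    RB : ∀ t → t < M → Rule B t
    RB t lt = backward-rule m t (good-backward m t (s≤s lt) ≤-refl)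
    e0 : A 0 ≡ B 0
    e0 = sym (trans (cong X (+-identityʳ m)) (periodic 0))
    e1 : A 1 ≡ B 1
    e1 = trans bounce (trans (sym (periodic M)) (cong X (trans (+-comm M m) (cong (m +_) (sym (+-identityʳ M))))))

  axis-at-hook-loop : X K1 ≡ X k → Axis 0
  axis-at-hook-loop loop t t≤k with m≤n⇒m<n∨m≡n t≤k
  ... | inj₂ refl = trans (sym loop) (trans (cong X (sym (m+n∸m≡n k K1))) (sym (X-times-M k k≤m)))
  ... | inj₁ (s≤s t≤K1) =
    trans (cong X (sym (m∸[m∸n]≡n t≤K1)))
     (trans (sym (X-backward K1 s (m∸n≤m K1 t)))
      (trans (sym (window-loop K2 ≤-refl loop s (m∸n≤m K1 t)))
       (trans (cong X (sym (+-∸-assoc k t≤K1))) (sym (X-times-M t (≤-trans t≤k k≤m))))))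
    where
    s : ℕ
    s = K1 ∸ t

  window-loop-case : ∀ i' → suc i' ≤ K1 → X (suc i') ≡ X (suc (suc i')) → HookRepeats ⊎ suc i' ≡ K1
  window-loop-case i' i≤K1 loop with suc i' ≟ K1
  ... | yes i≡K1 = inj₂ i≡K1
  ... | no i≢K1 = inj₁ (suc i + i , s≤s z≤n , +-mono-≤ i<K1 (<⇒≤ i<K1) ,
                        trans (window-loop i' (<⇒≤ i<K1) loop i ≤-refl)
                              (trans (X-backward i i ≤-refl) (cong X (n∸n≡0 i))))
    where
    i : ℕ
    i = suc i'
    i<K1 : i < K1
    i<K1 = ≤∧≢⇒< i≤K1 i≢K1

  inward-bound : ∀ i d → suc (suc i + suc d) ≡ i + suc (suc (suc d))
  inward-bound = solve-∀
  inward-pred : ∀ i d M → i + suc (suc (suc d)) + M ≡ suc i + suc d + suc M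
  inward-pred = solve-∀
  inward-sum : ∀ i d → suc i + (suc i + suc d) ≡ i + (i + suc (suc (suc d)))
  inward-sum = solve-∀

  -- A repeat X i = X j with 1 ≤ i < j ≤ k either makes the hook colour recur,
  -- or reflects inwards onto a central loop X (k-1) = X k, and then i + j = m.
  window-repeat : ∀ d i → 1 ≤ i → i + suc d ≤ k → X i ≡ X (i + suc d) →
                  HookRepeats ⊎ (X K1 ≡ X k × i + (i + suc d) ≡ m)
  window-repeat d zero () _ _
  window-repeat d (suc i') _ j≤k e
    with samePair-match (good-same-colour (off-hook i (s≤s z≤n) (≤-trans (m≤m+n i (suc d)) (≤-trans j≤k k≤M)))
                                          (off-hook j (s≤s z≤n) (≤-trans j≤k k≤M)) e)
    where
    i j : ℕ
    i = suc i'
    j = i + suc d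
  ... | inj₁ (pred≡ , _) = inj₁ (suc d , s≤s z≤n , ≤-trans (m≤n+m (suc d) (suc i')) (≤-trans j≤k k≤M) ,
                                 sym (window-parallel i' d (≤-trans j≤k k≤m) e pred≡))
  window-repeat zero (suc i') _ j≤k e | inj₂ _ =
    [ inj₁ , (λ i≡K1 → inj₂ (subst (λ z → X z ≡ X (suc z)) i≡K1 loop ,
                             trans (cong (λ z → z + (z + 1)) i≡K1) (central K1))) ]
    (window-loop-case i' (s≤s⁻¹ (≤-trans (≤-reflexive (+-comm 1 (suc i'))) j≤k)) loop)
    where
    loop : X (suc i') ≡ X (suc (suc i'))
    loop = trans e (cong X (+-comm (suc i') 1))
    central : ∀ x → x + (x + 1) ≡ suc (x + x)
    central = solve-∀
  window-repeat (suc zero) (suc i') _ j≤k e | inj₂ _ =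
    inj₁ (a + a , s≤s z≤n , 2a≤M , sym (window-bounce i 2a≤M bounce))
    where
    i a : ℕ
    i = suc i'
    a = suc i
    a≤K1 : a ≤ K1
    a≤K1 = s≤s⁻¹ (≤-trans (≤-reflexive (+-comm 2 i)) j≤k)
    2a≤M : a + a ≤ M
    2a≤M = +-mono-≤ a≤K1 a≤K1
    bounce : X (suc a) ≡ X (a + M)
    bounce = trans (cong X (+-comm 2 i)) (trans (sym e) (trans (sym (periodic i)) (cong X (+-suc i M))))
  window-repeat (suc (suc d')) (suc i') _ j≤k e | inj₂ (_ , succ≡pred)
    with window-repeat d' (suc (suc i')) (s≤s z≤n)
           (≤-trans (n≤1+n _) (≤-trans (≤-reflexive (inward-bound (suc i') d')) j≤k))
           (trans succ≡pred (trans (cong X (inward-pred (suc i') d' M)) (periodic (suc (suc i') + suc d'))))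
  ... | inj₁ c = inj₁ c
  ... | inj₂ (loop , sum) = inj₂ (loop , trans (sym (inward-sum (suc i') d')) sum)

  distinct-window : ¬ HookRepeats → ∀ i j → i < j → j ≤ K1 → X i ≢ X j
  distinct-window none zero j 0<j j≤K1 e = none (j , 0<j , ≤-trans j≤K1 (m≤m+n K1 K1) , sym e)
  distinct-window none (suc i) j i<j j≤K1 e with <⇒+suc i<j
  ... | d , refl with window-repeat d (suc i) (s≤s z≤n) (≤-trans j≤K1 (n≤1+n K1)) e
  ...   | inj₁ c = none c
  ...   | inj₂ (_ , sum) = <-irrefl sum (s≤s (+-mono-≤ (≤-trans (m≤m+n (suc i) (suc d)) j≤K1) j≤K1))

  window-onto : ¬ HookRepeats → ∀ y → ∃[ t ] X (toℕ {k} t) ≡ y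
  window-onto none = injective⇒surjective (λ t → X (toℕ t)) (injective-from-< (λ t → X (toℕ t)) separated)
    where
    separated : ∀ (i j : Fin k) → toℕ i < toℕ j → X (toℕ i) ≢ X (toℕ j)
    separated i j lt = distinct-window none (toℕ i) (toℕ j) lt (≤-pred (toℕ<n j))

  ρ-on-cycle : ∃[ u ] X u ≡ ρ
  ρ-on-cycle with hookRepeats?
  ... | yes (s , 1≤s , s≤M , e) with proj₁ (off-hook s 1≤s s≤M ρ) (subst (λ z → N z ρ) (sym e) hook-ρ)
  ...   | inj₁ q = s + M , sym q
  ...   | inj₂ q = suc s , sym q
  ρ-on-cycle | no none with window-onto none ρ
  ...   | t , e = toℕ t , e

  -- Colours occurring on the cycle are closed under N: a neighbour of a
  -- cycle colour is a cycle colour or ρ.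
  on-cycle-closed : ∀ {y z} → ∃[ u ] X u ≡ y → N y z → ∃[ u ] X u ≡ z
  on-cycle-closed {z = z} (u , refl) n with u % m ≟ 0
  ... | yes u≡0 with at-hook z (subst (λ w → N w z) (trans (X-mod u) (cong X u≡0)) n)
  ...   | inj₁ (inj₁ q) = M , sym q
  ...   | inj₁ (inj₂ q) = 1 , sym q
  ...   | inj₂ q = proj₁ ρ-on-cycle , trans (proj₂ ρ-on-cycle) (sym q)
  on-cycle-closed {z = z} (u , refl) n | no u≢0 with proj₁ (good-offHook u (n≢0⇒n>0 u≢0) z) n
  ...   | inj₁ q = u + M , sym q
  ...   | inj₂ q = suc u , sym q

  on-cycle : ∀ y → ∃[ u ] X u ≡ y
  on-cycle y = along (connected (X 0) y) (0 , refl)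
    where
    along : ∀ {x y} → Walk N x y → ∃[ u ] X u ≡ x → ∃[ u ] X u ≡ y
    along here p = p
    along (step n w) p = along w (on-cycle-closed p n)

  on-cycle-from : ∀ p y → ∃[ r ] (r < m × X (p + r) ≡ y)
  on-cycle-from p y with on-cycle y
  ... | u , e = (u + p * M) % m , m%n<n (u + p * M) m , trans (X-cong-mod same-residue) e
    where
    regroup : ∀ p u M → p + (u + p * M) ≡ u + p * suc M
    regroup = solve-∀
    same-residue : (p + (u + p * M) % m) % m ≡ u % m
    same-residue = trans (%-absorbʳ p (u + p * M) m) (trans (cong (_% m) (regroup p u M)) ([m+kn]%n≡m%n u p m))

  -- X has no translation symmetry of period D < k across a full window: the
  -- D colours X p, …, X (p+D-1) would then be all k colours.
  no-short-period : ∀ p d → suc d ≤ K1 → (∀ t → t ≤ m → X (p + t) ≡ X (p + suc d + t)) → ⊥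
  no-short-period p d D≤K1 shift = 1+n≰n (≤-trans (surjection⇒≤ (λ x → X (p + toℕ x)) covered) D≤K1)
    where
    D : ℕ
    D = suc d
    regroup : ∀ p r q D → p + (r + suc q * D) ≡ p + D + (r + q * D)
    regroup = solve-∀
    reduce-by-period : ∀ q r → r + q * D ≤ m → X (p + (r + q * D)) ≡ X (p + r)
    reduce-by-period zero r _ = cong (λ z → X (p + z)) (+-identityʳ r)
    reduce-by-period (suc q) r le = trans (cong X (regroup p r q D)) (trans (sym (shift (r + q * D) le')) (reduce-by-period q r le'))
      where
      le' : r + q * D ≤ m
      le' = ≤-trans (+-monoʳ-≤ r (m≤n+m (q * D) D)) le
    covered : ∀ y → ∃[ x ] X (p + toℕ {D} x) ≡ y
    covered y with on-cycle-from p y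
    ... | t , t<m , e = fromℕ< (m%n<n t D) ,
          trans (cong (λ z → X (p + z)) (toℕ-fromℕ< (m%n<n t D)))
           (trans (sym (reduce-by-period (t / D) (t % D) (≤-trans (≤-reflexive (sym (m≡m%n+[m/n]*n t D))) (<⇒≤ t<m))))
            (trans (cong (λ z → X (p + z)) (sym (m≡m%n+[m/n]*n t D))) e))

  good-everywhere : Good 0 → ∀ i → Good i
  good-everywhere G0 i with i % m ≟ 0
  ... | yes i≡0 = good-mod (trans (m<n⇒m%n≡m {n = m} (s≤s z≤n)) (sym i≡0)) G0
  ... | no i≢0 = good-offHook i (n≢0⇒n>0 i≢0)

  module AllGood (everywhere : ∀ i → Good i) where

    axis-bounce : ∀ a → X (suc a) ≡ X (a + M) → Axis a
    axis-bounce a bounce t t≤k =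
      agree A B k (λ t _ → forward-rule a t (everywhere _)) (λ t _ → backward-rule a t (everywhere _))
            refl e1 t (≤-trans t≤k (n≤1+n k))
      where
      A B : ℕ → Colour
      A t = X (a + t)
      B t = X (a + t * M)
      e1 : A 1 ≡ B 1
      e1 = trans (cong X (+-comm a 1)) (trans bounce (cong (λ z → X (a + z)) (sym (+-identityʳ M))))

    -- A loop X b = X (b+1) mirrors X about b + 1/2, which makes b + k an axis.
    axis-loop : ∀ b → X b ≡ X (suc b) → Axis (b + k)
    axis-loop b loop t t≤k =
      trans (cong X (past-loop b K2 t))
       (trans (mirror (K1 + t) (≤-trans (+-monoʳ-≤ K1 t≤k) (≤-trans (≤-reflexive (+-suc K1 K1)) (n≤1+n m))))
        (trans (cong X (opposite b K2 t)) (X-periodic (b + k + t * M) K2)))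
      where
      past-loop : ∀ b K2 t → b + suc (suc K2) + t ≡ suc b + (suc K2 + t)
      past-loop = solve-∀
      opposite : ∀ b K2 t → b + (suc K2 + t) * (suc K2 + suc K2)
                            ≡ b + suc (suc K2) + t * (suc K2 + suc K2) + K2 * suc (suc K2 + suc K2)
      opposite = solve-∀
      A B : ℕ → Colour
      A t = X (suc b + t)
      B t = X (b + t * M)
      e0 : A 0 ≡ B 0
      e0 = trans (cong X (+-identityʳ (suc b))) (trans (sym loop) (cong X (sym (+-identityʳ b))))
      e1 : A 1 ≡ B 1
      e1 = trans (cong X (+-comm (suc b) 1))
            (trans (sym (loop-reflects b (everywhere b) (everywhere (suc b)) loop))
                   (cong (λ z → X (b + z)) (sym (+-identityʳ M))))
      mirror : ∀ t → t ≤ suc m → A t ≡ B t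
      mirror = agree A B m (λ t _ → forward-rule (suc b) t (everywhere _)) (λ t _ → backward-rule b t (everywhere _)) e0 e1

    translate : ∀ i j → X i ≡ X j → X (suc i) ≡ X (suc j) → ∀ t → t ≤ m → X (i + t) ≡ X (j + t)
    translate i j e e' t t≤m =
      agree (λ t → X (i + t)) (λ t → X (j + t)) m (λ t _ → forward-rule i t (everywhere _))
            (λ t _ → forward-rule j t (everywhere _))
            (trans (cong X (+-identityʳ i)) (trans e (cong X (sym (+-identityʳ j)))))
            (trans (cong X (+-comm i 1)) (trans e' (cong X (+-comm 1 j)))) t (≤-trans t≤m (n≤1+n m))

    -- A repeat X i = X (i+D) with D ≤ k: a parallel repeat is a translation
    -- of period D (excluded; period k is period -(k-1)); a crossed one moves
    -- inwards until it is a loop or a bounce.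
    axis-from-repeat : ∀ d i → suc d ≤ k → X i ≡ X (i + suc d) → ∃[ a ] Axis a
    axis-from-repeat d i D≤k e with samePair-match (good-same-colour (everywhere i) (everywhere (i + suc d)) e)
    ... | inj₁ (_ , succ≡) with suc d ≤? K1
    ...   | yes D≤K1 = ⊥-elim (no-short-period i d D≤K1 (translate i (i + suc d) e succ≡))
    ...   | no D≰K1 = ⊥-elim (no-period-k (subst (λ d → ∀ t → t ≤ m → X (i + t) ≡ X (i + suc d + t))
                                                   (≤-antisym (s≤s⁻¹ D≤k) (s≤s⁻¹ (≰⇒> D≰K1)))
                                                   (translate i (i + suc d) e succ≡)))
      where
      around : ∀ i K2 t → i + suc (suc K2) + suc K2 + t ≡ i + t + suc (suc K2 + suc K2)
      around = solve-∀
      no-period-k : (∀ t → t ≤ m → X (i + t) ≡ X (i + k + t)) → ⊥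
      no-period-k shift = no-short-period (i + k) K2 ≤-refl λ t t≤m →
        trans (sym (shift t t≤m)) (sym (trans (cong X (around i K2 t)) (periodic (i + t))))
    axis-from-repeat zero i _ e | inj₂ _ = i + k , axis-loop i (trans e (cong X (+-comm i 1)))
    axis-from-repeat (suc zero) i _ e | inj₂ _ =
      suc i , axis-bounce (suc i) (trans (cong X (+-comm 2 i)) (trans (sym e) (trans (sym (periodic i)) (cong X (+-suc i M)))))
    axis-from-repeat (suc (suc d')) i D≤k e | inj₂ (_ , succ≡pred) =
      axis-from-repeat d' (suc i) (≤-trans (n≤1+n _) (≤-trans (n≤1+n _) D≤k))
        (trans succ≡pred (trans (cong X (inward-pred i d' M)) (periodic (suc i + suc d'))))

  hook-pred : N (X 0) (X M)
  hook-pred = N-sym (subst (N (X M)) (periodic 0) (proj₂ (off-hook M (s≤s z≤n) ≤-refl (X (suc M))) (inj₂ refl)))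

  hook-succ : N (X 0) (X 1)
  hook-succ = N-sym (subst (N (X 1)) (periodic 0) (proj₂ (off-hook 1 (s≤s z≤n) (s≤s z≤n) (X (1 + M))) (inj₁ refl)))

  -- If the hook colour recurs off the hook, its neighbourhood has at most two
  -- elements; when the hook's cycle neighbours differ in colour, the hook is good.
  hook-good : X M ≢ X 1 → HookRepeats → Good 0
  hook-good split (s , 1≤s , s≤M , e) y = (λ n → oneOf-exhaust split (at-s hook-pred) (at-s hook-succ) (at-s n)) , back
    where
    at-s : ∀ {z} → N (X 0) z → OneOf z (X (s + M)) (X (suc s))
    at-s {z} n = proj₁ (off-hook s 1≤s s≤M z) (subst (λ w → N w z) (sym e) n)
    back : OneOf y (X M) (X 1) → N (X 0) y
    back (inj₁ refl) = hook-pred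
    back (inj₂ refl) = hook-succ

  repeat : ∃[ i ] ∃[ d ] (i + suc d ≤ k × X i ≡ X (i + suc d))
  repeat with pigeonhole ≤-refl (λ (t : Fin (suc k)) → X (toℕ t))
  ... | a , b , a<b , e with <⇒+suc a<b
  ...   | d , b≡ = toℕ a , d , subst (_≤ k) b≡ (≤-pred (toℕ<n b)) , trans e (cong X b≡)

  axis : ∃[ a ] Axis a
  axis with X 1 ≟F X M
  ... | yes bounce = 0 , axis-at-hook-bounce bounce
  ... | no split with hookRepeats? | repeat
  ...   | yes c | i , d , j≤k , e =
          AllGood.axis-from-repeat (good-everywhere (hook-good (split ∘ sym) c)) d i (≤-trans (m≤n+m _ i) j≤k) e
  ...   | no none | zero , d , j≤k , e = ⊥-elim (none (suc d , s≤s z≤n , ≤-trans j≤k k≤M , sym e))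
  ...   | no none | suc i , d , j≤k , e with window-repeat d (suc i) (s≤s z≤n) j≤k e
  ...     | inj₁ c = ⊥-elim (none c)
  ...     | inj₂ (loop , _) = 0 , axis-at-hook-loop loop

  module FromAxis (a : ℕ) (mirror : Axis a) where

    col : Fin k → Colour
    col t = X (a + toℕ t)

    -- Every colour is some col t: fold the window a, …, a+m-1 about a.
    col-onto : ∀ y → ∃[ t ] col t ≡ y
    col-onto y with on-cycle-from a y
    ... | r , r<m , e with r ≤? K1
    ...   | yes r≤K1 = fromℕ< (s≤s r≤K1) , trans (cong (λ z → X (a + z)) (toℕ-fromℕ< (s≤s r≤K1))) e
    ...   | no r≰K1 = fromℕ< (s≤s s≤K1) ,
            trans (cong (λ z → X (a + z)) (toℕ-fromℕ< (s≤s s≤K1)))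
                  (trans (mirror s (≤-trans s≤K1 (n≤1+n K1))) (trans folded e))
      where
      s : ℕ
      s = m ∸ r
      s≤K1 : s ≤ K1
      s≤K1 = ≤-trans (∸-mono {x = m} ≤-refl (≰⇒> r≰K1)) (≤-reflexive (m+n∸m≡n k K1))
      regroup : ∀ a s r M → a + s * M + (s + r) ≡ a + r + s * suc M
      regroup = solve-∀
      folded : X (a + s * M) ≡ X (a + r)
      folded = trans (sym (periodic (a + s * M)))
                (trans (cong (λ z → X (a + s * M + z)) (sym (m∸n+n≡m (<⇒≤ r<m))))
                 (trans (cong X (regroup a s r M)) (X-periodic (a + r) s)))

    col-index : ∀ t j → j ≤ K1 → col t ≡ X (a + j) → toℕ t ≡ j
    col-index t j j≤K1 e =
      trans (cong toℕ (surjective⇒injective col col-onto t (fromℕ< (s≤s j≤K1))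
                         (trans e (cong (λ z → X (a + z)) (sym (toℕ-fromℕ< (s≤s j≤K1)))))))
            (toℕ-fromℕ< (s≤s j≤K1))

    -- For 1 ≤ s ≤ k-1 the positions a+s and a-s differ by 2s < m, so one is off the hook.
    one-side-good : ∀ s → 1 ≤ s → s ≤ K1 → Good (a + s) ⊎ Good (a + s * M)
    one-side-good s 1≤s s≤K1 with (a + s) % m ≟ 0
    ... | no a+s≢0 = inj₁ (good-offHook _ (n≢0⇒n>0 a+s≢0))
    ... | yes a+s≡0 with (a + s * M) % m ≟ 0
    ...   | no a-s≢0 = inj₂ (good-offHook _ (n≢0⇒n>0 a-s≢0))
    ...   | yes a-s≡0 = ⊥-elim (m<n⇒n≢0 1≤s (m+n≡0⇒m≡0 s 2s≡0))
      where
      regroup : ∀ a s M → a + s * M + (s + s) ≡ a + s + s * suc M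
      regroup = solve-∀
      2s≡0 : s + s ≡ 0
      2s≡0 = trans (sym (m<n⇒m%n≡m (s≤s (+-mono-≤ s≤K1 s≤K1))))
              (trans (sym (%-cong-+ʳ m {a + s * M} {0} (s + s) a-s≡0))
               (trans (cong (_% m) (regroup a s M)) (trans ([m+kn]%n≡m%n (a + s) s m) a+s≡0)))

    -- The last colour has a loop: X (a+k) = X (a-k) = X (a+k-1).
    end-loop : X (a + k) ≡ X (a + K1)
    end-loop = trans (mirror k ≤-refl) (trans (cong X (regroup a K2)) (X-periodic (a + K1) K1))
      where
      regroup : ∀ a K2 → a + suc (suc K2) * (suc K2 + suc K2) ≡ a + suc K2 + suc K2 * suc (suc K2 + suc K2)
      regroup = solve-∀

    -- Off the axis the colours along the axis obey the path rule, read on the good side.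
    inner-rule : ∀ s → suc s ≤ K1 → Rule (λ t → X (a + t)) s
    inner-rule s s+1≤K1 with one-side-good (suc s) (s≤s z≤n) s+1≤K1
    ... | inj₁ G = forward-rule a s G
    ... | inj₂ G = rule-cong {λ t → X (a + t * M)} {λ t → X (a + t)} (sym (mirror s (≤-trans (n≤1+n s) s+1≤k)))
                                                                (sym (mirror (suc s) s+1≤k)) (sym (mirror (suc (suc s)) (s≤s s+1≤K1)))
                             (backward-rule a s G)
      where
      s+1≤k : suc s ≤ k
      s+1≤k = ≤-trans s+1≤K1 (n≤1+n K1)

    char-inner : ∀ s t → Iff (N (col (fsuc s)) (col t)) (PStarAdj k (fsuc s) t)
    char-inner s t = fw , bw
      where
      s' : ℕ
      s' = toℕ s
      s'+1≤K1 : suc s' ≤ K1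
      s'+1≤K1 = ≤-pred (toℕ<n (fsuc s))
      nbrs : Iff (N (col (fsuc s)) (col t)) (OneOf (col t) (X (a + s')) (X (a + suc (suc s'))))
      nbrs = inner-rule s' s'+1≤K1 (col t)
      fw : N (col (fsuc s)) (col t) → PStarAdj k (fsuc s) t
      fw n with proj₁ nbrs n
      ... | inj₁ e = inj₁ (inj₂ (cong suc (sym (col-index t s' (≤-trans (n≤1+n _) s'+1≤K1) e))))
      ... | inj₂ e with suc (suc s') ≤? K1
      ...   | yes s'+2≤K1 = inj₁ (inj₁ (col-index t _ s'+2≤K1 e))
      ...   | no s'+2≰K1 = inj₂ (toℕ-injective (trans last (sym t-last)) , last)
        where
        last : suc s' ≡ K1
        last = ≤-antisym s'+1≤K1 (s≤s⁻¹ (≰⇒> s'+2≰K1))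
        t-last : toℕ t ≡ K1
        t-last = col-index t K1 ≤-refl (trans e (trans (cong (λ z → X (a + suc z)) last) end-loop))
      bw : PStarAdj k (fsuc s) t → N (col (fsuc s)) (col t)
      bw (inj₁ (inj₁ e)) = proj₂ nbrs (inj₂ (cong (λ z → X (a + z)) e))
      bw (inj₁ (inj₂ e)) = proj₂ nbrs (inj₁ (cong (λ z → X (a + z)) (suc-injective (sym e))))
      bw (inj₂ (refl , last)) = proj₂ nbrs (inj₂ (sym (trans (cong (λ z → X (a + suc z)) last)
                                                    (trans end-loop (cong (λ z → X (a + z)) (sym last))))))

    FirstLoop : Set
    FirstLoop = a % m ≡ 0 × ρ ≡ col fzero

    hook-first : a % m ≡ 0 → X 0 ≡ col fzero
    hook-first a≡0 = X-cong-mod (sym (trans (cong (_% m) (+-identityʳ a)) a≡0))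

    hook-nbrs-second : a % m ≡ 0 → X M ≡ col (fsuc fzero) × X 1 ≡ col (fsuc fzero)
    hook-nbrs-second a≡0 =
      trans (X-cong-mod (sym (%-cong-+ʳ m {a} {0} M a≡0)))
            (trans (cong (λ z → X (a + z)) (sym (+-identityʳ M))) (sym (mirror 1 (s≤s z≤n)))) ,
      X-cong-mod (sym (%-cong-+ʳ m {a} {0} 1 a≡0))

    second-first : ∀ t → toℕ t ≡ 1 → N (col fzero) (col t)
    second-first fzero ()
    second-first (fsuc t) e = N-sym (proj₂ (char-inner t fzero) (inj₁ (inj₂ e)))

    ρ-case : a % m ≡ 0 → ∀ t → col t ≡ ρ → N (col fzero) (col t) → PStarAdj k fzero t ⊎ (FirstLoop × fzero ≡ t)
    ρ-case a≡0 fzero q _ = inj₂ ((a≡0 , sym q) , refl)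
    ρ-case a≡0 (fsuc t) _ n with proj₁ (char-inner t fzero) (N-sym n)
    ... | inj₁ (inj₁ ())
    ... | inj₁ (inj₂ e) = inj₁ (inj₁ (inj₁ e))
    ... | inj₂ (() , _)

    char-first : ∀ t → Iff (N (col fzero) (col t)) (PStarAdj k fzero t ⊎ (FirstLoop × fzero ≡ t))
    char-first t = fw , bw
      where
      second : col t ≡ X (a + 1) → PStarAdj k fzero t ⊎ (FirstLoop × fzero ≡ t)
      second e = inj₁ (inj₁ (inj₁ (col-index t 1 (s≤s z≤n) e)))
      fw : N (col fzero) (col t) → PStarAdj k fzero t ⊎ (FirstLoop × fzero ≡ t)
      fw n with a % m ≟ 0
      ... | no a≢0 = second (reduce (proj₁ (good-at (good-offHook a (n≢0⇒n>0 a≢0)) pred≡ (cong X (+-comm 1 a)) (col t))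
                                               (subst (λ z → N z (col t)) (cong X (+-identityʳ a)) n)))
        where
        pred≡ : X (a + M) ≡ X (a + 1)
        pred≡ = trans (cong (λ z → X (a + z)) (sym (+-identityʳ M))) (sym (mirror 1 (s≤s z≤n)))
      ... | yes a≡0 with at-hook (col t) (subst (λ z → N z (col t)) (sym (hook-first a≡0)) n)
      ...   | inj₁ (inj₁ q) = second (trans q (proj₁ (hook-nbrs-second a≡0)))
      ...   | inj₁ (inj₂ q) = second (trans q (proj₂ (hook-nbrs-second a≡0)))
      ...   | inj₂ q = ρ-case a≡0 t q n
      bw : PStarAdj k fzero t ⊎ (FirstLoop × fzero ≡ t) → N (col fzero) (col t)
      bw (inj₁ (inj₁ (inj₁ e))) = second-first t e
      bw (inj₁ (inj₁ (inj₂ ())))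
      bw (inj₁ (inj₂ (_ , ())))
      bw (inj₂ ((a≡0 , ρ≡) , refl)) = subst₂ N (hook-first a≡0) ρ≡ hook-ρ

    char-with-loop : FirstLoop → ∀ s t → Iff (N (col s) (col t)) (PStarStarAdj k s t)
    char-with-loop fl fzero t = [ inj₁ , (λ { (_ , refl) → inj₂ (refl , refl) }) ] ∘ proj₁ (char-first t) ,
                                [ proj₂ (char-first t) ∘ inj₁ , (λ { (refl , _) → proj₂ (char-first t) (inj₂ (fl , refl)) }) ]
    char-with-loop fl (fsuc s) t = inj₁ ∘ proj₁ (char-inner s t) , [ proj₂ (char-inner s t) , (λ { (_ , ()) }) ]

    char-without-loop : ¬ FirstLoop → ∀ s t → Iff (N (col s) (col t)) (PStarAdj k s t)
    char-without-loop nl fzero t = [ (λ p → p) , (λ { (fl , _) → ⊥-elim (nl fl) }) ] ∘ proj₁ (char-first t) ,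
                                   proj₂ (char-first t) ∘ inj₁
    char-without-loop nl (fsuc s) t = char-inner s t

    classify : Isomorphic N (PStarAdj k) ⊎ Isomorphic N (PStarStarAdj k)
    classify with (a % m ≟ 0) ×-dec (ρ ≟F col fzero)
    ... | yes fl = inj₂ (iso-from-onto N (PStarStarAdj k) col col-onto (char-with-loop fl))
    ... | no nl = inj₁ (iso-from-onto N (PStarAdj k) col col-onto (char-without-loop nl))

  role-graph-shape : Isomorphic N (PStarAdj k) ⊎ Isomorphic N (PStarStarAdj k)
  role-graph-shape = FromAxis.classify (proj₁ axis) (proj₂ axis)

role-nbr-realised : ∀ {G k r} → IsRoleColouring G k r → ∀ u y → RoleAdj G r (r u) y → ∃[ v ] (Edge G u v × r v ≡ y)
role-nbr-realised (_ , same-role) u y (u' , v' , ru'≡ru , rv'≡y , u'v') with proj₁ (same-role u' u ru'≡ru) v' u'v'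
... | v , uv , rv≡rv' = v , uv , trans rv≡rv' rv'≡y

role-adj-sym : ∀ {G k} {r : Fin (n G) → Fin k} {x y} → RoleAdj G r x y → RoleAdj G r y x
role-adj-sym {G} (u , v , ru , rv , uv) = v , u , rv , ru , trans (Graph.sym G v u) uv

%-cancel-+ˡ : ∀ x i n' → (x + i) % suc n' ≡ x % suc n' → i % suc n' ≡ 0
%-cancel-+ˡ x i n' e =
  trans (sym ([m+kn]%n≡m%n i x (suc n')))
   (trans (cong (_% suc n') (regroup x i n'))
    (trans (sym (%-absorbˡ (x + i) (x * n') (suc n')))
     (trans (cong (λ z → (z + x * n') % suc n') e)
      (trans (%-absorbˡ x (x * n') (suc n'))
       (trans (cong (_% suc n') (multiple x n')) (m*n%n≡0 x (suc n')))))))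
  where
  regroup : ∀ x i n' → i + x * suc n' ≡ x + i + x * n'
  regroup = solve-∀
  multiple : ∀ x n' → x + x * n' ≡ x * suc n'
  multiple = solve-∀

module FromGraph (K2 : ℕ) (G : Graph)
  (r : Fin (n G) → Fin (suc (suc K2))) (rc : IsRoleColouring G (suc (suc K2)) r)
  (f : Fin (suc (suc K2 + suc K2)) → Fin (n G))
  (f-iso : ∀ i j → Edge G (f i) (f j) ⇔ CycleAdj (suc (suc K2 + suc K2)) i j)
  (h : Fin (suc (suc K2 + suc K2))) (w : Fin (n G))
  (hook-w : Edge G (f h) w)
  (hook-only-w : ∀ w' → Outside G f w' → Edge G (f h) w' → w' ≡ w)
  (no-escape : ∀ i → i ≢ h → ∀ w' → Outside G f w' → ¬ Edge G (f i) w')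
  where

  M m : ℕ
  M = suc K2 + suc K2
  m = suc M

  pos : ℕ → Fin m
  pos i = fromℕ< (m%n<n (toℕ h + i) m)

  toℕ-pos : ∀ i → toℕ (pos i) ≡ (toℕ h + i) % m
  toℕ-pos i = toℕ-fromℕ< (m%n<n (toℕ h + i) m)

  vertex : ℕ → Fin (n G)
  vertex i = f (pos i)

  X : ℕ → Fin (suc (suc K2))
  X i = r (vertex i)

  periodic : ∀ i → X (i + m) ≡ X i
  periodic i = cong (r ∘ f) (toℕ-injective (trans (toℕ-pos (i + m))
    (trans (cong (_% m) (sym (+-assoc (toℕ h) i m))) (trans ([m+n]%n≡m%n (toℕ h + i) m) (sym (toℕ-pos i))))))

  pos-0 : pos 0 ≡ h
  pos-0 = toℕ-injective (trans (toℕ-pos 0) (trans (cong (_% m) (+-identityʳ (toℕ h))) (m<n⇒m%n≡m (toℕ<n h))))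

  pos-off-hook : ∀ i → 1 ≤ i → i ≤ M → pos i ≢ h
  pos-off-hook i 1≤i i≤M e = m<n⇒n≢0 1≤i (trans (sym (m<n⇒m%n≡m (s≤s i≤M)))
    (%-cancel-+ˡ (toℕ h) i M (trans (sym (toℕ-pos i)) (trans (cong toℕ e) (sym (m<n⇒m%n≡m (toℕ<n h)))))))

  pos-suc : ∀ i → suc (toℕ (pos i)) % m ≡ toℕ (pos (suc i))
  pos-suc i = trans (cong (λ z → suc z % m) (toℕ-pos i)) (trans (%-absorbʳ 1 (toℕ h + i) m)
                (trans (cong (_% m) (sym (+-suc (toℕ h) i))) (sym (toℕ-pos (suc i)))))

  pos-pred : ∀ i → suc (toℕ (pos (i + M))) % m ≡ toℕ (pos i)
  pos-pred i = trans (pos-suc (i + M)) (trans (toℕ-pos (suc (i + M))) (trans (cong (_% m) (+-suc (toℕ h) (i + M)))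
                 (trans (cong (_% m) (regroup (toℕ h) i M)) (trans ([m+n]%n≡m%n (toℕ h + i) m) (sym (toℕ-pos i))))))
    where
    regroup : ∀ h i M → suc (h + (i + M)) ≡ h + i + suc M
    regroup = solve-∀

  cycle-nbrs : ∀ i j → CycleAdj m (pos i) j → j ≡ pos (suc i) ⊎ j ≡ pos (i + M)
  cycle-nbrs i j (inj₁ e) = inj₁ (toℕ-injective (trans e (pos-suc i)))
  cycle-nbrs i j (inj₂ e) = inj₂ (toℕ-injective (
    trans (sym (m<n⇒m%n≡m (toℕ<n j))) (trans (sym ([m+n]%n≡m%n (toℕ j) m))
     (trans (cong (_% m) (+-suc (toℕ j) M)) (trans (sym (%-absorbˡ (suc (toℕ j)) M m))
      (trans (cong (λ z → (z + M) % m) (sym e)) (trans (cong (λ z → (z + M) % m) (toℕ-pos i))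
       (trans (%-absorbˡ (toℕ h + i) M m) (trans (cong (_% m) (+-assoc (toℕ h) i M)) (sym (toℕ-pos (i + M))))))))))))

  edge-succ : ∀ i → Edge G (vertex i) (vertex (suc i))
  edge-succ i = Equivalence.from (f-iso (pos i) (pos (suc i))) (inj₁ (sym (pos-suc i)))

  edge-pred : ∀ i → Edge G (vertex i) (vertex (i + M))
  edge-pred i = Equivalence.from (f-iso (pos i) (pos (i + M))) (inj₂ (sym (pos-pred i)))

  vertex-nbrs : ∀ i v → Edge G (vertex i) v → v ≡ vertex (suc i) ⊎ v ≡ vertex (i + M) ⊎ Outside G f v
  vertex-nbrs i v e with any? (λ j → f j ≟F v)
  ... | no outside = inj₂ (inj₂ (λ j fj≡v → outside (j , fj≡v)))
  ... | yes (j , fj≡v) with cycle-nbrs i j (Equivalence.to (f-iso (pos i) j) (subst (Edge G (vertex i)) (sym fj≡v) e))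
  ...   | inj₁ q = inj₁ (trans (sym fj≡v) (cong f q))
  ...   | inj₂ q = inj₂ (inj₁ (trans (sym fj≡v) (cong f q)))

  off-hook : ∀ i → 1 ≤ i → i ≤ M → ∀ y → Iff (RoleAdj G r (X i) y) (OneOf y (X (i + M)) (X (suc i)))
  off-hook i 1≤i i≤M y = fw , bw
    where
    fw : RoleAdj G r (X i) y → OneOf y (X (i + M)) (X (suc i))
    fw n with role-nbr-realised {G} rc (vertex i) y n
    ... | v , e , rv≡y with vertex-nbrs i v e
    ...   | inj₁ q = inj₂ (trans (sym rv≡y) (cong r q))
    ...   | inj₂ (inj₁ q) = inj₁ (trans (sym rv≡y) (cong r q))
    ...   | inj₂ (inj₂ out) = ⊥-elim (no-escape (pos i) (pos-off-hook i 1≤i i≤M) v out e)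
    bw : OneOf y (X (i + M)) (X (suc i)) → RoleAdj G r (X i) y
    bw (inj₁ q) = vertex i , vertex (i + M) , refl , sym q , edge-pred i
    bw (inj₂ q) = vertex i , vertex (suc i) , refl , sym q , edge-succ i

  at-hook : ∀ y → RoleAdj G r (X 0) y → OneOf y (X M) (X 1) ⊎ y ≡ r w
  at-hook y n with role-nbr-realised {G} rc (vertex 0) y n
  ... | v , e , rv≡y with vertex-nbrs 0 v e
  ...   | inj₁ q = inj₁ (inj₂ (trans (sym rv≡y) (cong r q)))
  ...   | inj₂ (inj₁ q) = inj₁ (inj₁ (trans (sym rv≡y) (cong r q)))
  ...   | inj₂ (inj₂ out) = inj₂ (trans (sym rv≡y) (cong r (hook-only-w v out (subst (λ z → Edge G (f z) v) pos-0 e))))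

  hook-ρ : RoleAdj G r (X 0) (r w)
  hook-ρ = vertex 0 , w , refl , refl , subst (λ z → Edge G (f z) w) (sym pos-0) hook-w

  role-graph-shape : Connected (RoleAdj G r) →
    Isomorphic (RoleAdj G r) (PStarAdj (suc (suc K2))) ⊎ Isomorphic (RoleAdj G r) (PStarStarAdj (suc (suc K2)))
  role-graph-shape = RoleCycle.role-graph-shape K2 X (RoleAdj G r) (r w) periodic off-hook at-hook hook-ρ (role-adj-sym {G})

cycle-length : ∀ K2 → 2 * suc (suc K2) ∸ 2 ≡ suc K2 + suc K2
cycle-length K2 = trans (+-suc K2 (suc (K2 + 0))) (cong suc (cong (K2 +_) (cong suc (+-identityʳ K2))))

lemma3 : (k : ℕ) → k ≥ 2 → (G : Graph) →
    HasDanglingCycle G (suc (2 * k ∸ 2)) →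
    (r : Fin (n G) → Fin k) → IsRoleColouring G k r →
    Connected (RoleAdj G r) →
    Isomorphic (RoleAdj G r) (PStarAdj k) ⊎ Isomorphic (RoleAdj G r) (PStarStarAdj k)
lemma3 (suc (suc K2)) _ G dangling r rc connected
  with subst (λ M → HasDanglingCycle G (suc M)) (cycle-length K2) dangling
... | f , (_ , f-iso) , (h , (w , _ , hook-w , hook-only-w) , no-escape) =
  FromGraph.role-graph-shape K2 G r rc f f-iso h w hook-w hook-only-w no-escape connected
lemma3 (suc zero) (s≤s ()) _ _ _ _ _
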